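{- Let $\mathfrak{C}$ be a class of dynamic operators $\star$ satisfying (DP1) and $\mathfrak{M}\subseteq \mathit{Mod}(\mathcal{L}_\leq)$ be a class of preference models. The following axiom schemata are valid in $\langle \mathfrak{M}, \mathfrak{C}\rangle$ for any $\varphi \in \mathcal{L}_0$ and $\xi \in \mathcal{L}_\leq(\star)$: $$ \begin{array}{lcl} {}[\star\varphi][\leq]\xi &\rightarrow& (\varphi \rightarrow [\leq](\varphi \rightarrow [\star\varphi] \xi))\\ {}[\star\varphi][<]\xi &\rightarrow& (\varphi \rightarrow [<](\varphi \rightarrow [\star\varphi] \xi))\\ {}[\leq][\star\varphi]\xi &\rightarrow& (\varphi \rightarrow [\star\varphi][\leq](\varphi \rightarrow \xi))\\ {}[<][\star\varphi]\xi &\rightarrow& (\varphi \rightarrow [\star\varphi][<](\varphi \rightarrow \xi)) \end{array}$$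
   Context: Fix a set $P$ of propositional letters; $\mathcal{L}_0$ is the classical propositional language over $P$. A (well-founded) preference model is $M=\langle W,\leq,v\rangle$ with $W$ a set of worlds, $\leq$ a reflexive, transitive relation on $W$ whose strict part $<$ is well-founded, and $v:P\to 2^W$ a valuation; $\mathit{Mod}(\mathcal{L}_\leq)$ is the class of all such models. A dynamic operator is a map $\star:\mathit{Mod}(\mathcal{L}_\leq)\times\mathcal{L}_0\to\mathit{Mod}(\mathcal{L}_\leq)$ with $\star(M,\varphi)=\langle W,\leq_{\star\varphi},v\rangle$ (same worlds and valuation). The language $\mathcal{L}_\leq(\star)$ is built from $P$ with $\neg,\wedge$, the universal modality $A$, the modalities $[\leq]$, $[<]$, and formulas $[\star\varphi]\xi$ with $\varphi\in\mathcal{L}_0$. A dynamic model is $D=\langle M,\star\rangle$, with $D,w\vDash[\leq]\xi$ iff every $w'\leq w$ satisfies $\xi$, $D,w\vDash[<]\xi$ iff every $w'<w$ satisfies $\xi$, $A$ universal, and $D,w\vDash[\star\varphi]\xi$ iff $\langle\star(M,\varphi),\star\rangle,w\vDash\xi$. For a class $\mathfrak{M}$ of preference models and a class $\mathfrak{C}$ of dynamic operators closed over $\mathfrak{M}$, $\langle\mathfrak{M},\mathfrak{C}\rangle$ is the class of dynamic models $\langle M,\star\rangle$ with $M\in\mathfrak{M}$, $\star\in\mathfrak{C}$; a formula is valid in it if true at every world of every such model. $[\![\varphi]\!]$ denotes the set of worlds of the model satisfying $\varphi$. $\star$ satisfies (DP1) if for every model and every $\varphi\in\mathcal{L}_0$: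 if $w,w'\in[\![\varphi]\!]$, then $w\leq_{\star\varphi}w'$ iff $w\leq w'$. -}

module Defs where

open import Level using (0ℓ)
open import Data.Product using (_×_; _,_)
open import Relation.Nullary using (¬_)
open import Relation.Binary.Core using (Rel)
open import Relation.Binary.Definitions using (Reflexive; Transitive)
open import Induction.WellFounded using (WellFounded)

data Form0 (P : Set) : Set where
  atom0 : P → Form0 P
  ¬0_   : Form0 P → Form0 P
  _∧0_  : Form0 P → Form0 P → Form0 P

Strict : {W : Set} → Rel W 0ℓ → Rel W 0ℓ
Strict _≤_ x y = x ≤ y × ¬ (y ≤ x)

record PrefOrder (W : Set) : Set₁ where
  field
    _≤_   : Rel W 0ℓ
    ≤-refl  : Reflexive _≤_
    ≤-trans : Transitive _≤_
    <-wf    : WellFounded (Strict _≤_)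

record PrefModel (P : Set) : Set₁ where
  field
    W   : Set
    ord : PrefOrder W
    v   : P → W → Set
  open PrefOrder ord public

open PrefModel public

sat0 : {P : Set} (M : PrefModel P) → W M → Form0 P → Set
sat0 M w (atom0 p) = v M p w
sat0 M w (¬0 φ)    = ¬ sat0 M w φ
sat0 M w (φ ∧0 ψ)  = sat0 M w φ × sat0 M w ψ

-- A dynamic operator: ⋆(M, φ) = ⟨W, ≤_{⋆φ}, v⟩, i.e. it yields a new
-- well-founded preference order on the same worlds (same valuation).
DynOp : Set → Set₁
DynOp P = (M : PrefModel P) → Form0 P → PrefOrder (W M)

update : {P : Set} → DynOp P → PrefModel P → Form0 P → PrefModel P
update ⋆ M φ = record { W = W M ; ord = ⋆ M φ ; v = v M }

data Form (P : Set) : Set where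
  atom  : P → Form P
  ¬'_   : Form P → Form P
  _∧'_  : Form P → Form P → Form P
  A     : Form P → Form P
  [≤]_  : Form P → Form P
  [<]_  : Form P → Form P
  [⋆_]_ : Form0 P → Form P → Form P

infixr 6 ¬'_ [≤]_ [<]_ [⋆_]_
infixr 5 _∧'_
infixr 4 _⇒_
infixr 6 ¬0_
infixr 5 _∧0_

emb : {P : Set} → Form0 P → Form P
emb (atom0 p) = atom p
emb (¬0 φ)    = ¬' emb φ
emb (φ ∧0 ψ)  = emb φ ∧' emb ψ

_⇒_ : {P : Set} → Form P → Form P → Form P
a ⇒ b = ¬' (a ∧' ¬' b)

sat : {P : Set} (M : PrefModel P) (⋆ : DynOp P) → W M → Form P → Set
sat M ⋆ w (atom p)   = v M p w
sat M ⋆ w (¬' ξ)     = ¬ sat M ⋆ w ξ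
sat M ⋆ w (ξ ∧' χ)   = sat M ⋆ w ξ × sat M ⋆ w χ
sat M ⋆ w (A ξ)      = ∀ w' → sat M ⋆ w' ξ
sat M ⋆ w ([≤] ξ)    = ∀ w' → _≤_ M w' w → sat M ⋆ w' ξ
sat M ⋆ w ([<] ξ)    = ∀ w' → Strict (_≤_ M) w' w → sat M ⋆ w' ξ
sat M ⋆ w ([⋆ φ ] ξ) = sat (update ⋆ M φ) ⋆ w ξ

DP1 : {P : Set} → DynOp P → Set₁
DP1 {P} ⋆ = ∀ (M : PrefModel P) (φ : Form0 P) (w w' : W M) →
  sat0 M w φ → sat0 M w' φ →
  (PrefOrder._≤_ (⋆ M φ) w w' → _≤_ M w w') × (_≤_ M w w' → PrefOrder._≤_ (⋆ M φ) w w')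

ClosedOver : {P : Set} → (DynOp P → Set₁) → (PrefModel P → Set₁) → Set₁
ClosedOver {P} ℭ 𝔐 = ∀ (⋆ : DynOp P) → ℭ ⋆ → ∀ (M : PrefModel P) → 𝔐 M → ∀ φ → 𝔐 (update ⋆ M φ)

Valid : {P : Set} → (PrefModel P → Set₁) → (DynOp P → Set₁) → Form P → Set₁
Valid {P} 𝔐 ℭ ξ = ∀ (M : PrefModel P) → 𝔐 M → ∀ (⋆ : DynOp P) → ℭ ⋆ → ∀ (w : W M) → sat M ⋆ w ξ

-- On φ-worlds (DP1) makes ≤ and ≤_{⋆φ} coincide, hence also their strict parts.
-- Each schema then transfers a box across the update: restricted to φ-worlds,
-- the worlds below w before the update are exactly those below w after it,
-- and φ itself is unaffected because the update keeps the valuation.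
module Submission where

open import Level using (0ℓ)
open import Data.Product using (_×_; _,_; proj₁; proj₂)
open import Function using (_∘_)
open import Relation.Binary.Core using (Rel)

open import Defs

Strict-mono : {W : Set} {R S : Rel W 0ℓ} {x y : W} →
  (R x y → S x y) → (S y x → R y x) → Strict R x y → Strict S x y
Strict-mono R⇒S S⇒R (rxy , ¬ryx) = R⇒S rxy , ¬ryx ∘ S⇒R

module _ {P : Set} (M : PrefModel P) (⋆ : DynOp P) where

  -- The formulas are explicit because Agda cannot recover them from the
  -- unfolded type: sat is not injective.
  ⇒-intro : (a b : Form P) {w : W M} →
    (sat M ⋆ w a → sat M ⋆ w b) → sat M ⋆ w (a ⇒ b)
  ⇒-intro _ _ a→b (sa , ¬sb) = ¬sb (a→b sa)

  ⇒-intro₂ : (a b c : Form P) {w : W M} →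
    (sat M ⋆ w a → sat M ⋆ w b → sat M ⋆ w c) → sat M ⋆ w (a ⇒ (b ⇒ c))
  ⇒-intro₂ a b c a→b→c = ⇒-intro a (b ⇒ c) (⇒-intro b c ∘ a→b→c)

  sat-emb⇒sat0 : (w : W M) (φ : Form0 P) → sat M ⋆ w (emb φ) → sat0 M w φ
  sat0⇒sat-emb : (w : W M) (φ : Form0 P) → sat0 M w φ → sat M ⋆ w (emb φ)
  sat-emb⇒sat0 w (atom0 p) s       = s
  sat-emb⇒sat0 w (¬0 φ)    ¬s      = ¬s ∘ sat0⇒sat-emb w φ
  sat-emb⇒sat0 w (φ ∧0 ψ) (s , t) = sat-emb⇒sat0 w φ s , sat-emb⇒sat0 w ψ t
  sat0⇒sat-emb w (atom0 p) s       = s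
  sat0⇒sat-emb w (¬0 φ)    ¬s      = ¬s ∘ sat-emb⇒sat0 w φ
  sat0⇒sat-emb w (φ ∧0 ψ) (s , t) = sat0⇒sat-emb w φ s , sat0⇒sat-emb w ψ t

  sat0-update⇒sat0 : (χ : Form0 P) (w : W M) (φ : Form0 P) →
    sat0 (update ⋆ M χ) w φ → sat0 M w φ
  sat0⇒sat0-update : (χ : Form0 P) (w : W M) (φ : Form0 P) →
    sat0 M w φ → sat0 (update ⋆ M χ) w φ
  sat0-update⇒sat0 χ w (atom0 p) s       = s
  sat0-update⇒sat0 χ w (¬0 φ)    ¬s      = ¬s ∘ sat0⇒sat0-update χ w φ
  sat0-update⇒sat0 χ w (φ ∧0 ψ) (s , t) =
    sat0-update⇒sat0 χ w φ s , sat0-update⇒sat0 χ w ψ t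
  sat0⇒sat0-update χ w (atom0 p) s       = s
  sat0⇒sat0-update χ w (¬0 φ)    ¬s      = ¬s ∘ sat0-update⇒sat0 χ w φ
  sat0⇒sat0-update χ w (φ ∧0 ψ) (s , t) =
    sat0⇒sat0-update χ w φ s , sat0⇒sat0-update χ w ψ t

sat-emb-update⇒sat0 : {P : Set} (M : PrefModel P) (⋆ : DynOp P) (φ : Form0 P) (w : W M) →
  sat (update ⋆ M φ) ⋆ w (emb φ) → sat0 M w φ
sat-emb-update⇒sat0 M ⋆ φ w = sat0-update⇒sat0 M ⋆ φ w φ ∘ sat-emb⇒sat0 (update ⋆ M φ) ⋆ w φ

module _ {P : Set} {⋆ : DynOp P} (dp1 : DP1 ⋆) (M : PrefModel P) (φ : Form0 P) where

  private
    _≤⋆_ = PrefOrder._≤_ (⋆ M φ)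
    _≤ᴹ_ = _≤_ M

  DP1-≤⇒≤⋆ : {w w' : W M} → sat0 M w φ → sat0 M w' φ → w ≤ᴹ w' → w ≤⋆ w'
  DP1-≤⇒≤⋆ φw φw' = proj₂ (dp1 M φ _ _ φw φw')

  DP1-≤⋆⇒≤ : {w w' : W M} → sat0 M w φ → sat0 M w' φ → w ≤⋆ w' → w ≤ᴹ w'
  DP1-≤⋆⇒≤ φw φw' = proj₁ (dp1 M φ _ _ φw φw')

  DP1-<⇒<⋆ : {w w' : W M} → sat0 M w φ → sat0 M w' φ →
    Strict _≤ᴹ_ w w' → Strict _≤⋆_ w w'
  DP1-<⇒<⋆ φw φw' = Strict-mono {R = _≤ᴹ_} {S = _≤⋆_} (DP1-≤⇒≤⋆ φw φw') (DP1-≤⋆⇒≤ φw' φw)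

  DP1-<⋆⇒< : {w w' : W M} → sat0 M w φ → sat0 M w' φ →
    Strict _≤⋆_ w w' → Strict _≤ᴹ_ w w'
  DP1-<⋆⇒< φw φw' = Strict-mono {R = _≤⋆_} {S = _≤ᴹ_} (DP1-≤⋆⇒≤ φw φw') (DP1-≤⇒≤⋆ φw' φw)

  update-[≤]-reduction : (ξ : Form P) (w : W M) →
    sat M ⋆ w (([⋆ φ ] ([≤] ξ)) ⇒ (emb φ ⇒ ([≤] (emb φ ⇒ ([⋆ φ ] ξ)))))
  update-[≤]-reduction ξ w =
    ⇒-intro₂ M ⋆ ([⋆ φ ] ([≤] ξ)) (emb φ) ([≤] (emb φ ⇒ ([⋆ φ ] ξ))) λ □ξ φw w' w'≤w →
      ⇒-intro M ⋆ (emb φ) ([⋆ φ ] ξ) λ φw' →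
        □ξ w' (DP1-≤⇒≤⋆ (sat-emb⇒sat0 M ⋆ w' φ φw') (sat-emb⇒sat0 M ⋆ w φ φw) w'≤w)

  update-[<]-reduction : (ξ : Form P) (w : W M) →
    sat M ⋆ w (([⋆ φ ] ([<] ξ)) ⇒ (emb φ ⇒ ([<] (emb φ ⇒ ([⋆ φ ] ξ)))))
  update-[<]-reduction ξ w =
    ⇒-intro₂ M ⋆ ([⋆ φ ] ([<] ξ)) (emb φ) ([<] (emb φ ⇒ ([⋆ φ ] ξ))) λ □ξ φw w' w'<w →
      ⇒-intro M ⋆ (emb φ) ([⋆ φ ] ξ) λ φw' →
        □ξ w' (DP1-<⇒<⋆ (sat-emb⇒sat0 M ⋆ w' φ φw') (sat-emb⇒sat0 M ⋆ w φ φw) w'<w)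

  [≤]-update-reduction : (ξ : Form P) (w : W M) →
    sat M ⋆ w (([≤] ([⋆ φ ] ξ)) ⇒ (emb φ ⇒ ([⋆ φ ] ([≤] (emb φ ⇒ ξ)))))
  [≤]-update-reduction ξ w =
    ⇒-intro₂ M ⋆ ([≤] ([⋆ φ ] ξ)) (emb φ) ([⋆ φ ] ([≤] (emb φ ⇒ ξ))) λ □ξ φw w' w'≤⋆w →
      ⇒-intro (update ⋆ M φ) ⋆ (emb φ) ξ λ φw' →
        □ξ w' (DP1-≤⋆⇒≤ (sat-emb-update⇒sat0 M ⋆ φ w' φw') (sat-emb⇒sat0 M ⋆ w φ φw) w'≤⋆w)

  [<]-update-reduction : (ξ : Form P) (w : W M) →
    sat M ⋆ w (([<] ([⋆ φ ] ξ)) ⇒ (emb φ ⇒ ([⋆ φ ] ([<] (emb φ ⇒ ξ)))))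
  [<]-update-reduction ξ w =
    ⇒-intro₂ M ⋆ ([<] ([⋆ φ ] ξ)) (emb φ) ([⋆ φ ] ([<] (emb φ ⇒ ξ))) λ □ξ φw w' w'<⋆w →
      ⇒-intro (update ⋆ M φ) ⋆ (emb φ) ξ λ φw' →
        □ξ w' (DP1-<⋆⇒< (sat-emb-update⇒sat0 M ⋆ φ w' φw') (sat-emb⇒sat0 M ⋆ w φ φw) w'<⋆w)

proposition22 : (P : Set) (𝔐 : PrefModel P → Set₁) (ℭ : DynOp P → Set₁) →
    ClosedOver ℭ 𝔐 → (∀ ⋆ → ℭ ⋆ → DP1 ⋆) →
    ∀ (φ : Form0 P) (ξ : Form P) →
      Valid 𝔐 ℭ (([⋆ φ ] ([≤] ξ)) ⇒ (emb φ ⇒ ([≤] (emb φ ⇒ ([⋆ φ ] ξ)))))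
      × Valid 𝔐 ℭ (([⋆ φ ] ([<] ξ)) ⇒ (emb φ ⇒ ([<] (emb φ ⇒ ([⋆ φ ] ξ)))))
      × Valid 𝔐 ℭ (([≤] ([⋆ φ ] ξ)) ⇒ (emb φ ⇒ ([⋆ φ ] ([≤] (emb φ ⇒ ξ)))))
      × Valid 𝔐 ℭ (([<] ([⋆ φ ] ξ)) ⇒ (emb φ ⇒ ([⋆ φ ] ([<] (emb φ ⇒ ξ)))))
proposition22 P 𝔐 ℭ _ ℭ⊆DP1 φ ξ =
    (λ M _ ⋆ ⋆∈ℭ → update-[≤]-reduction (ℭ⊆DP1 ⋆ ⋆∈ℭ) M φ ξ)
  , (λ M _ ⋆ ⋆∈ℭ → update-[<]-reduction (ℭ⊆DP1 ⋆ ⋆∈ℭ) M φ ξ)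
  , (λ M _ ⋆ ⋆∈ℭ → [≤]-update-reduction (ℭ⊆DP1 ⋆ ⋆∈ℭ) M φ ξ)
  , (λ M _ ⋆ ⋆∈ℭ → [<]-update-reduction (ℭ⊆DP1 ⋆ ⋆∈ℭ) M φ ξ)
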